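{- Let $T$ be a tree, $\{u,v\}$ an edge of $T$, and $\mathcal{S}$ a finite multiset of rooted subtrees of $T$ each of which contains the directed edge $(u,v)$ or the directed edge $(v,u)$. Then the complement $\bar{G}_{\mathcal{S}}$ of the conflict graph $G_{\mathcal{S}}$ is bipartite.
   Context: A directed graph is a rooted tree if its underlying undirected multigraph is a tree, exactly one vertex has in-degree $0$, and all other vertices have in-degree $1$; it is a rooted subtree of $T$ if in addition its underlying undirected graph is a subtree of $T$. Two rooted subtrees collide if they share a directed edge. The conflict graph $G_{\mathcal{S}}$ has the members of $\mathcal{S}$ as vertices, with two vertices adjacent iff the corresponding rooted subtrees collide. -}

module Defs where

open import Data.Nat using (ℕ; zero; suc; _+_)
open import Data.Fin using (Fin)
open import Data.Bool using (Bool; true; false; _∨_; _∧_; if_then_else_)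
open import Data.List using (List; []; _∷_; map)
open import Data.Nat.ListAction using (sum)
open import Data.Unit using (⊤)
open import Data.List using (allFin) public
open import Data.List.Relation.Unary.All using (All)
open import Data.List.Relation.Unary.Unique.Propositional using (Unique)
open import Data.Product using (Σ; ∃; _×_; _,_)
open import Relation.Binary.PropositionalEquality using (_≡_; _≢_)
open import Relation.Nullary using (¬_)

-- A (simple, finite) graph on a subset of the vertex set Fin n:
-- V = vertex set (as a Boolean predicate), E = adjacency relation.
-- Walks inside the graph.
data Walk {n : ℕ} (V : Fin n → Bool) (E : Fin n → Fin n → Bool) : Fin n → Fin n → Set where
  here : ∀ {x} → V x ≡ true → Walk V E x x
  step : ∀ {x y z} → V x ≡ true → E x y ≡ true → Walk V E y z → Walk V E x z

Connected : {n : ℕ} → (Fin n → Bool) → (Fin n → Fin n → Bool) → Set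
Connected V E = ∀ x y → V x ≡ true → V y ≡ true → Walk V E x y

ChainClosed : {n : ℕ} → (Fin n → Fin n → Bool) → Fin n → List (Fin n) → Set
ChainClosed E first [] = ⊤
ChainClosed E first (x ∷ []) = E x first ≡ true
ChainClosed E first (x ∷ y ∷ xs) = E x y ≡ true × ChainClosed E first (y ∷ xs)

Cycle : {n : ℕ} → (Fin n → Bool) → (Fin n → Fin n → Bool) → Set
Cycle {n} V E =
  Σ (Fin n) λ a → Σ (Fin n) λ b → Σ (Fin n) λ c → Σ (List (Fin n)) λ xs →
    Unique (a ∷ b ∷ c ∷ xs) × All (λ x → V x ≡ true) (a ∷ b ∷ c ∷ xs)
    × ChainClosed E a (a ∷ b ∷ c ∷ xs)

IsTree : {n : ℕ} → (Fin n → Bool) → (Fin n → Fin n → Bool) → Set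
IsTree {n} V E = (∃ λ x → V x ≡ true) × Connected V E × ¬ Cycle V E

record Tree (n : ℕ) : Set where
  field
    adj     : Fin n → Fin n → Bool
    sym     : ∀ x y → adj x y ≡ adj y x
    irrefl  : ∀ x → adj x x ≡ false
    isTree  : IsTree (λ _ → true) adj
open Tree public

indeg : {n : ℕ} → (Fin n → Fin n → Bool) → Fin n → ℕ
indeg {n} A y = sum (map (λ x → if A x y then 1 else 0) (allFin n))

record RootedSubtree {n : ℕ} (T : Tree n) : Set where
  field
    verts     : Fin n → Bool
    arcs      : Fin n → Fin n → Bool
    arcs-in   : ∀ x y → arcs x y ≡ true → verts x ≡ true × verts y ≡ true
    arcs-T    : ∀ x y → arcs x y ≡ true → adj T x y ≡ true
    -- no pair of antiparallel arcs (would be a 2-cycle in the underlying multigraph)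
    no-anti   : ∀ x y → arcs x y ≡ true → arcs y x ≡ false
    und-tree  : IsTree verts (λ x y → arcs x y ∨ arcs y x)
    root      : Fin n
    root-in   : verts root ≡ true
    root-deg  : indeg arcs root ≡ 0
    other-deg : ∀ y → verts y ≡ true → y ≢ root → indeg arcs y ≡ 1
open RootedSubtree public

Collide : {n : ℕ} {T : Tree n} → RootedSubtree T → RootedSubtree T → Set
Collide {n} S₁ S₂ = Σ (Fin n) λ x → Σ (Fin n) λ y → arcs S₁ x y ≡ true × arcs S₂ x y ≡ true

-- A finite multiset of rooted subtrees is a family 𝒮 : Fin m → RootedSubtree T
-- (members indexed by position, so repetitions are allowed).
ConflictAdj : {n m : ℕ} {T : Tree n} → (Fin m → RootedSubtree T) → Fin m → Fin m → Set
ConflictAdj 𝒮 i j = i ≢ j × Collide (𝒮 i) (𝒮 j)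

ComplConflictAdj : {n m : ℕ} {T : Tree n} → (Fin m → RootedSubtree T) → Fin m → Fin m → Set
ComplConflictAdj 𝒮 i j = i ≢ j × ¬ ConflictAdj 𝒮 i j

Bipartite : {m : ℕ} → (Fin m → Fin m → Set) → Set
Bipartite {m} R = Σ (Fin m → Bool) λ c → ∀ i j → R i j → c i ≢ c j

-- Colour a member by whether it contains the arc (u,v).  Two
-- members of the same colour then share an arc — (u,v) if both contain it,
-- otherwise both contain (v,u) — so they collide.  Hence each colour class is
-- a clique of the conflict graph G_𝒮, i.e. an independent set of its
-- complement, and the colouring is a proper 2-colouring of the complement.
module Submission where

open import Defs
open import Data.Nat using (ℕ)
open import Data.Fin using (Fin)
open import Data.Bool using (Bool; true; false; _∨_)
open import Data.Product using (_×_; _,_)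
open import Relation.Binary.PropositionalEquality using (_≡_; _≢_; refl) renaming (sym to ≡-sym)
open import Relation.Nullary using (¬_)

cliqueClasses⇒properOnComplement :
  {m : ℕ} (R : Fin m → Fin m → Set) (c : Fin m → Bool) →
  (∀ i j → c i ≡ c j → R i j) →
  ∀ i j → i ≢ j × ¬ (i ≢ j × R i j) → c i ≢ c j
cliqueClasses⇒properOnComplement R c sameColour⇒R i j (i≢j , nonAdjacent) ci≡cj =
  nonAdjacent (i≢j , sameColour⇒R i j ci≡cj)

∨-resolveˡ : ∀ {a b : Bool} → (a ∨ b) ≡ true → a ≡ false → b ≡ true
∨-resolveˡ a∨b refl = a∨b

-- Two rooted subtrees that each contain (u,v) or (v,u), and agree on whether
-- they contain (u,v), share one of these two arcs and hence collide.  (When S₁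
-- omits (u,v), its hypothesis reduces to false ∨ b ≡ true, i.e. (v,u) ∈ S₁.)
sameOrientation⇒collide : {n : ℕ} {T : Tree n} (u v : Fin n) (S₁ S₂ : RootedSubtree T) →
  (arcs S₁ u v ∨ arcs S₁ v u) ≡ true →
  (arcs S₂ u v ∨ arcs S₂ v u) ≡ true →
  arcs S₁ u v ≡ arcs S₂ u v → Collide S₁ S₂
sameOrientation⇒collide u v S₁ S₂ through₁ through₂ agree with arcs S₁ u v in uv∈S₁
... | true  = u , v , uv∈S₁ , ≡-sym agree
... | false = v , u , through₁ , ∨-resolveˡ through₂ (≡-sym agree)

lemma1 : {n m : ℕ} (T : Tree n) (u v : Fin n) → adj T u v ≡ true →
    (𝒮 : Fin m → RootedSubtree T) →
    (∀ i → (arcs (𝒮 i) u v ∨ arcs (𝒮 i) v u) ≡ true) →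
    Bipartite (ComplConflictAdj 𝒮)
lemma1 T u v _ 𝒮 through = colour , cliqueClasses⇒properOnComplement
  (λ i j → Collide (𝒮 i) (𝒮 j)) colour
  (λ i j → sameOrientation⇒collide u v (𝒮 i) (𝒮 j) (through i) (through j))
  where
  colour : Fin _ → Bool
  colour i = arcs (𝒮 i) u v
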